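{- Let $C>0$, $T>0$, and let $\eta$ satisfy $T/C\le\eta\le 1$ and $\eta C+T<C$. Then for every transaction sequence $\mathsf{Tx}$ with all values at most $T$, \[ V_{\mathrm{OPT}}(\mathsf{Tx}) \le \frac{C}{C-\eta C-T}\, V_{\mathrm{A}_\eta}(\mathsf{Tx}), \] where both values are total settled transaction values in the general collateral model $\mathcal{M}^C_T$.
   Context: General collateral model $\mathcal{M}^{C}_T$: time is divided into discrete slots $t=1,2,\dots$; a transaction sequence $\mathsf{Tx}=(\mathsf{tx}_1,\dots,\mathsf{tx}_n)$ has $\mathsf{tx}_t\in[0,T]$ the value of the transaction arriving at slot $t$ (value $0$ = no transaction). There is a single pool of total collateral $C$. Each arriving transaction of value $v$ must immediately be settled, which requires at least $v$ currently available collateral and commits $v$ of it, or discarded. Any portion of committed collateral may be flushed at any time; collateral flushed at time $t$ is unavailable during $(t,t+F]$ ($F$ a fixed positive integer) and available again afterwards. $V_{\mathrm{A}}(\mathsf{Tx})$ is the total value settled by policy $\mathrm{A}$; $\mathrm{OPT}$ is the optimal offline policy (with full knowledge of $\mathsf{Tx}$) maximizing settled value. Threshold algorithm $\mathrm{A}_\eta$: let $R$ denote the collateral currently committed but not yet flushed. When a transaction arrives, it is settled if and only if there is sufficient available collateral. Immediately after settling a transaction, if $R\ge \eta C$, the algorithm flushes exactly $\eta C$ of the committed collateral.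
   Formalization: The collateral C, the bound T, the threshold η, the transaction values and the amounts of collateral flushed are rational numbers rather than real numbers. -}

module Defs where

open import Data.Bool using (Bool; true; false; if_then_else_)
open import Data.Nat as ℕ using (ℕ; _∸_)
open import Data.Product using (_×_; _,_)
open import Data.Unit using (⊤)
open import Data.List using (List; []; _∷_; _++_; [_]; foldr; map; drop; length)
open import Data.List.Relation.Unary.All using (All)
open import Data.Rational using (ℚ; 0ℚ; _+_; _-_; _*_; _≤_; _<_)
open import Data.Rational.Properties using (_≤?_; _<?_)
open import Relation.Binary.PropositionalEquality using (_≡_)
open import Relation.Nullary.Decidable using (does)

sumℚ : List ℚ → ℚ
sumℚ = foldr _+_ 0ℚ

-- What happens in one slot: the value of the arriving transaction
-- (0 = no transaction), whether it is settled, and the amount of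
-- committed collateral flushed at this slot (after the settlement decision).
record Step : Set where
  constructor step
  field
    value   : ℚ
    settled : Bool
    flushed : ℚ
open Step public

settledAmt : Step → ℚ
settledAmt s = if settled s then value s else 0ℚ

-- A history is the list of steps of slots 0,1,...,k-1 (k = its length).
-- R: collateral committed but not yet flushed.
committed : List Step → ℚ
committed h = sumℚ (map settledAmt h) - sumℚ (map flushed h)

-- Collateral flushed at slot t is unavailable during (t, t+F]; at the
-- current slot k = length h these are the flushes of slots t with k-F ≤ t < k.
inTransit : ℕ → List Step → ℚ
inTransit F h = sumℚ (map flushed (drop (length h ∸ F) h))

available : ℚ → ℕ → List Step → ℚ
available C F h = C - committed h - inTransit F h

FeasibleFrom : ℚ → ℕ → List Step → List Step → Set
FeasibleFrom C F h [] = ⊤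
FeasibleFrom C F h (s ∷ rest) =
  (settled s ≡ true → value s ≤ available C F h) ×
  (0ℚ ≤ flushed s) ×
  (flushed s ≤ committed h + settledAmt s) ×
  FeasibleFrom C F (h ++ [ s ]) rest

Feasible : ℚ → ℕ → List Step → Set
Feasible C F run = FeasibleFrom C F [] run

RunOn : List ℚ → List Step → Set
RunOn Tx run = map value run ≡ Tx

settledValue : List Step → ℚ
settledValue run = sumℚ (map settledAmt run)

thresholdDecide : ℚ → ℕ → ℚ → List Step → ℚ → Step
thresholdDecide C F η h v =
  if does (0ℚ <? v) Data.Bool.∧ does (v ≤? available C F h)
  then step v true (if does ((η * C) ≤? (committed h + v)) then η * C else 0ℚ)
  else step v false 0ℚ

thresholdFrom : ℚ → ℕ → ℚ → List Step → List ℚ → List Step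
thresholdFrom C F η h [] = []
thresholdFrom C F η h (v ∷ vs) =
  let s = thresholdDecide C F η h v in s ∷ thresholdFrom C F η (h ++ [ s ]) vs

thresholdRun : ℚ → ℕ → ℚ → List ℚ → List Step
thresholdRun C F η Tx = thresholdFrom C F η [] Tx

V-threshold : ℚ → ℕ → ℚ → List ℚ → ℚ
V-threshold C F η Tx = settledValue (thresholdRun C F η Tx)

{-# OPTIONS --safe #-}
module Submission where

open import Defs
open import Data.Bool using (true; false; if_then_else_; _∧_)
open import Data.Nat using (ℕ; zero; suc; _∸_; s≤s)
import Data.Nat as ℕ
import Data.Nat.Properties as ℕ
open import Data.Nat.Induction using (<-rec)
open import Data.List using (List; []; _∷_; _++_; [_]; map; take; drop; length)
open import Data.List.Properties
  using (map-++; ++-assoc; ++-identityʳ; take++drop≡id; take-take; length-take;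
         take-all; take-map; length-map)
open import Data.List.Relation.Unary.All as All using (All; []; _∷_)
open import Data.List.Relation.Unary.All.Properties using (map⁺; map⁻; take⁺)
open import Data.Product using (_×_; _,_; proj₁; proj₂)
open import Data.Sum using (_⊎_; inj₁; inj₂)
open import Data.Rational using (ℚ; 0ℚ; 1ℚ; _+_; _-_; _*_; _≤_; _<_; -_; nonNegative)
open import Data.Rational.Properties
  using (_≤?_; _<?_; ≤-refl; ≤-reflexive; ≤-trans; <⇒≤; <-≤-trans; ≮⇒≥; ≰⇒>;
         +-identityˡ; +-identityʳ; +-assoc; +-inverseʳ; *-zeroˡ; *-zeroʳ;
         +-mono-≤; +-mono-<-≤; +-monoʳ-≤; +-monoˡ-≤; +-monoˡ-<; +-monoʳ-<; *-monoˡ-≤-nonNeg)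
open import Data.Rational.Solver using (module +-*-Solver)
open import Relation.Binary.PropositionalEquality
  using (_≡_; refl; sym; trans; cong; cong₂; subst; subst₂; module ≡-Reasoning)
open import Relation.Nullary using (Dec; yes; no; does)

-- Compare the two runs prefix by prefix: with S(j) the value settled in the
-- slots before j, show S_OPT(j) · (C − ηC − T) ≤ C · S_A(j) by strong
-- induction on j. In any run, the collateral unavailable at slot j was either
-- settled during the last F slots or still committed F slots earlier; and A_η
-- keeps its committed, unflushed collateral below ηC, because it flushes ηC as
-- soon as that much is committed and each transaction adds at most T ≤ ηC.
-- Hence when A_η settles the transaction of slot j it gains at least what OPT
-- gains, and when it rejects it for lack of collateral it has settled more
-- than C − ηC − T during the last F slots, while OPT settled at most C during
-- those slots and slot j; the induction hypothesis at j − F closes the gap.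

private
  variable
    A B : Set

module _ where
  open +-*-Solver

  p≤q⇒0≤q-p : ∀ {p q} → p ≤ q → 0ℚ ≤ q - p
  p≤q⇒0≤q-p {p} {q} p≤q = subst (_≤ q - p) (+-inverseʳ p) (+-monoˡ-≤ (- p) p≤q)

  p<q⇒0<q-p : ∀ {p q} → p < q → 0ℚ < q - p
  p<q⇒0<q-p {p} {q} p<q = subst (_< q - p) (+-inverseʳ p) (+-monoˡ-< (- p) p<q)

  p+[q-p]≡q : ∀ p q → p + (q - p) ≡ q
  p+[q-p]≡q = solve 2 (λ p q → p :+ (q :- p) := q) refl

  0≤q-p⇒p≤q : ∀ {p q} → 0ℚ ≤ q - p → p ≤ q
  0≤q-p⇒p≤q {p} {q} 0≤q-p = subst₂ _≤_ (+-identityʳ p) (p+[q-p]≡q p q) (+-monoʳ-≤ p 0≤q-p)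

  0<q-p⇒p<q : ∀ {p q} → 0ℚ < q - p → p < q
  0<q-p⇒p<q {p} {q} 0<q-p = subst₂ _<_ (+-identityʳ p) (p+[q-p]≡q p q) (+-monoʳ-< p 0<q-p)

  *-nonNeg : ∀ {p q} → 0ℚ ≤ p → 0ℚ ≤ q → 0ℚ ≤ p * q
  *-nonNeg {p} {q} 0≤p 0≤q =
    subst (_≤ p * q) (*-zeroʳ p) (*-monoˡ-≤-nonNeg p {{nonNegative 0≤p}} 0≤q)

  p+0-0≡p : ∀ p → p + 0ℚ - 0ℚ ≡ p
  p+0-0≡p p = trans (+-identityʳ (p + 0ℚ)) (+-identityʳ p)

  committed-identity : ∀ S Φ a f → (S + a) - (Φ + f) ≡ (S - Φ) + a - f
  committed-identity = solve 4 (λ S Φ a f → (S :+ a) :- (Φ :+ f) := (S :- Φ) :+ a :- f) refl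

  available-identity : ∀ C S S′ Φ′ I → C - (S - (Φ′ + I)) - I ≡ C - (S - S′) - (S′ - Φ′)
  available-identity =
    solve 5 (λ C S S′ Φ′ I → C :- (S :- (Φ′ :+ I)) :- I := C :- (S :- S′) :- (S′ :- Φ′)) refl

  -- Each inequality below holds because the difference of its two sides is
  -- a sum of manifestly nonnegative terms.

  ≤-by-difference : ∀ {p q} d → 0ℚ ≤ d → d ≡ q - p → p ≤ q
  ≤-by-difference d 0≤d refl = 0≤q-p⇒p≤q 0≤d

  <-by-difference : ∀ {p q} d → 0ℚ < d → d ≡ q - p → p < q
  <-by-difference d 0<d refl = 0<q-p⇒p<q 0<d

  settle-within-window : ∀ {C S S′ R v} → v ≤ C - (S - S′) - R → 0ℚ ≤ R → S + v ≤ C + S′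
  settle-within-window {C} {S} {S′} {R} {v} fits 0≤R =
    ≤-by-difference _ (+-mono-≤ (p≤q⇒0≤q-p fits) 0≤R)
      (solve 5 (λ C S S′ R v → ((C :- (S :- S′) :- R) :- v) :+ R := (C :+ S′) :- (S :+ v))
             refl C S S′ R v)

  reject-within-window : ∀ {C S S′ R v T k} →
    C - (S - S′) - R < v → v ≤ T → R < k → C - k - T + S′ < S
  reject-within-window {C} {S} {S′} {R} {v} {T} {k} short v≤T R<k =
    <-by-difference _
      (+-mono-<-≤ (p<q⇒0<q-p short) (+-mono-≤ (p≤q⇒0≤q-p v≤T) (<⇒≤ (p<q⇒0<q-p R<k))))
      (solve 7 (λ C S S′ R v T k →
                  (v :- (C :- (S :- S′) :- R)) :+ ((T :- v) :+ (k :- R)) := S :- (C :- k :- T :+ S′))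
             refl C S S′ R v T k)

  flush-restores : ∀ {R v k T} → R < k → v ≤ T → T ≤ k → R + v - k < k
  flush-restores {R} {v} {k} {T} R<k v≤T T≤k =
    <-by-difference _
      (+-mono-<-≤ (p<q⇒0<q-p R<k) (+-mono-≤ (p≤q⇒0≤q-p T≤k) (p≤q⇒0≤q-p v≤T)))
      (solve 4 (λ R v k T → (k :- R) :+ ((k :- T) :+ (T :- v)) := k :- (R :+ v :- k)) refl R v k T)

  gain-preserves-ratio : ∀ {C c X Y a b} →
    X * c ≤ C * Y → a ≤ b → 0ℚ ≤ b → 0ℚ ≤ c → c ≤ C → (X + a) * c ≤ C * (Y + b)
  gain-preserves-ratio {C} {c} {X} {Y} {a} {b} ratio a≤b 0≤b 0≤c c≤C =
    ≤-by-difference _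
      (+-mono-≤ (p≤q⇒0≤q-p ratio)
                (+-mono-≤ (*-nonNeg (p≤q⇒0≤q-p c≤C) 0≤b) (*-nonNeg 0≤c (p≤q⇒0≤q-p a≤b))))
      (solve 6 (λ C c X Y a b →
                  (C :* Y :- X :* c) :+ ((C :- c) :* b :+ c :* (b :- a)) := C :* (Y :+ b) :- (X :+ a) :* c)
             refl C c X Y a b)

  window-preserves-ratio : ∀ {C c X X′ Y Y′} →
    X′ ≤ C + X → X * c ≤ C * Y → c + Y ≤ Y′ → 0ℚ ≤ c → 0ℚ ≤ C → X′ * c ≤ C * Y′
  window-preserves-ratio {C} {c} {X} {X′} {Y} {Y′} X′≤C+X ratio c+Y≤Y′ 0≤c 0≤C =
    ≤-by-difference _
      (+-mono-≤ (*-nonNeg 0≤c (p≤q⇒0≤q-p X′≤C+X))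
                (+-mono-≤ (p≤q⇒0≤q-p ratio) (*-nonNeg 0≤C (p≤q⇒0≤q-p c+Y≤Y′))))
      (solve 6 (λ C c X X′ Y Y′ →
                  c :* ((C :+ X) :- X′) :+ ((C :* Y :- X :* c) :+ C :* (Y′ :- (c :+ Y)))
                    := C :* Y′ :- X′ :* c)
             refl C c X X′ Y Y′)

  slack-positive : ∀ {C k T} → k + T < C → 0ℚ < C - k - T
  slack-positive {C} {k} {T} k+T<C =
    subst (0ℚ <_) (solve 3 (λ C k T → C :- (k :+ T) := C :- k :- T) refl C k T) (p<q⇒0<q-p k+T<C)

  slack-≤ : ∀ {C k T} → 0ℚ ≤ k → 0ℚ ≤ T → C - k - T ≤ C
  slack-≤ {C} {k} {T} 0≤k 0≤T =
    ≤-by-difference _ (+-mono-≤ 0≤k 0≤T)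
      (solve 3 (λ C k T → k :+ T := C :- (C :- k :- T)) refl C k T)

nth : A → List A → ℕ → A
nth d []       _       = d
nth d (x ∷ xs) zero    = x
nth d (x ∷ xs) (suc j) = nth d xs j

nth-map : ∀ (f : A → B) d xs j → nth (f d) (map f xs) j ≡ f (nth d xs j)
nth-map f d []       j       = refl
nth-map f d (x ∷ xs) zero    = refl
nth-map f d (x ∷ xs) (suc j) = nth-map f d xs j

All-nth : ∀ {P : A → Set} d {xs} {j} → All P xs → j ℕ.< length xs → P (nth d xs j)
All-nth d {j = zero}  (p ∷ _)  _         = p
All-nth d {j = suc j} (_ ∷ ps) (s≤s j<n) = All-nth d ps j<n

take-suc-nth : ∀ d (xs : List A) {j} → j ℕ.< length xs →
  take (suc j) xs ≡ take j xs ++ [ nth d xs j ]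
take-suc-nth d (x ∷ xs) {zero}  _         = refl
take-suc-nth d (x ∷ xs) {suc j} (s≤s j<n) = cong (x ∷_) (take-suc-nth d xs j<n)

take-take-≤ : ∀ {m j} (xs : List A) → m ℕ.≤ j → take m (take j xs) ≡ take m xs
take-take-≤ {m = m} {j} xs m≤j =
  trans (take-take m j xs) (cong (λ i → take i xs) (ℕ.m≤n⇒m⊓n≡m m≤j))

length-take-≤ : ∀ {j} (xs : List A) → j ℕ.≤ length xs → length (take j xs) ≡ j
length-take-≤ {j = j} xs j≤n = trans (length-take j xs) (ℕ.m≤n⇒m⊓n≡m j≤n)

sumℚ-++ : ∀ xs ys → sumℚ (xs ++ ys) ≡ sumℚ xs + sumℚ ys
sumℚ-++ []       ys = sym (+-identityˡ (sumℚ ys))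
sumℚ-++ (x ∷ xs) ys = trans (cong (x +_) (sumℚ-++ xs ys)) (sym (+-assoc x (sumℚ xs) (sumℚ ys)))

sumℚ-map-++ : ∀ (f : A → ℚ) xs ys →
  sumℚ (map f (xs ++ ys)) ≡ sumℚ (map f xs) + sumℚ (map f ys)
sumℚ-map-++ f xs ys = trans (cong sumℚ (map-++ f xs ys)) (sumℚ-++ (map f xs) (map f ys))

sumℚ-map-∷ʳ : ∀ (f : A → ℚ) xs x → sumℚ (map f (xs ++ [ x ])) ≡ sumℚ (map f xs) + f x
sumℚ-map-∷ʳ f xs x = trans (sumℚ-map-++ f xs [ x ]) (cong (sumℚ (map f xs) +_) (+-identityʳ (f x)))

sumℚ-nonneg : ∀ {xs} → All (0ℚ ≤_) xs → 0ℚ ≤ sumℚ xs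
sumℚ-nonneg []         = ≤-refl
sumℚ-nonneg (0≤x ∷ ps) = +-mono-≤ 0≤x (sumℚ-nonneg ps)

sumℚ-take-mono : ∀ {xs m j} → All (0ℚ ≤_) xs → m ℕ.≤ j → sumℚ (take m xs) ≤ sumℚ (take j xs)
sumℚ-take-mono {_}     {zero}  {j}     ps       _         = sumℚ-nonneg (take⁺ j ps)
sumℚ-take-mono {[]}    {suc m} {suc j} []       _         = ≤-refl
sumℚ-take-mono {x ∷ _} {suc m} {suc j} (_ ∷ ps) (s≤s m≤j) = +-monoʳ-≤ x (sumℚ-take-mono ps m≤j)

idle : Step
idle = step 0ℚ false 0ℚ

flushedValue : List Step → ℚ
flushedValue h = sumℚ (map flushed h)

settledAmt-nonneg : ∀ s → 0ℚ ≤ value s → 0ℚ ≤ settledAmt s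
settledAmt-nonneg (step v true  f) 0≤v = 0≤v
settledAmt-nonneg (step v false f) _   = ≤-refl

settledAmt-≤-value : ∀ s → 0ℚ ≤ value s → settledAmt s ≤ value s
settledAmt-≤-value (step v true  f) _   = ≤-refl
settledAmt-≤-value (step v false f) 0≤v = 0≤v

settledValue-∷ʳ : ∀ h s → settledValue (h ++ [ s ]) ≡ settledValue h + settledAmt s
settledValue-∷ʳ = sumℚ-map-∷ʳ settledAmt

committed-∷ʳ : ∀ h s → committed (h ++ [ s ]) ≡ committed h + settledAmt s - flushed s
committed-∷ʳ h s = trans (cong₂ _-_ (settledValue-∷ʳ h s) (sumℚ-map-∷ʳ flushed h s))
                         (committed-identity (settledValue h) (flushedValue h) (settledAmt s) (flushed s))

settledValue-take-suc : ∀ r {j} → j ℕ.< length r →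
  settledValue (take (suc j) r) ≡ settledValue (take j r) + settledAmt (nth idle r j)
settledValue-take-suc r {j} j<n =
  trans (cong settledValue (take-suc-nth idle r j<n)) (settledValue-∷ʳ (take j r) (nth idle r j))

committed-take-suc : ∀ r {j} → j ℕ.< length r →
  committed (take (suc j) r) ≡ committed (take j r) + settledAmt (nth idle r j) - flushed (nth idle r j)
committed-take-suc r {j} j<n =
  trans (cong committed (take-suc-nth idle r j<n)) (committed-∷ʳ (take j r) (nth idle r j))

settledValue-take-mono : ∀ {r m j} → All (λ s → 0ℚ ≤ value s) r → m ℕ.≤ j →
  settledValue (take m r) ≤ settledValue (take j r)
settledValue-take-mono {r} {m} {j} 0≤values m≤j =
  subst₂ _≤_ (cong sumℚ (take-map m r)) (cong sumℚ (take-map j r))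
    (sumℚ-take-mono (map⁺ (All.map (λ {s} → settledAmt-nonneg s) 0≤values)) m≤j)

inTransit-take : ∀ F r {j} → j ℕ.≤ length r →
  flushedValue (take j r) ≡ flushedValue (take (j ∸ F) r) + inTransit F (take j r)
inTransit-take F r {j} j≤n = begin
  flushedValue (take j r)
    ≡⟨ cong flushedValue (sym (take++drop≡id (j ∸ F) (take j r))) ⟩
  flushedValue (take (j ∸ F) (take j r) ++ drop (j ∸ F) (take j r))
    ≡⟨ sumℚ-map-++ flushed (take (j ∸ F) (take j r)) _ ⟩
  flushedValue (take (j ∸ F) (take j r)) + flushedValue (drop (j ∸ F) (take j r))
    ≡⟨ cong₂ _+_ (cong flushedValue (take-take-≤ r (ℕ.m∸n≤m j F)))
                 (cong (λ i → flushedValue (drop (i ∸ F) (take j r))) (sym (length-take-≤ r j≤n))) ⟩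
  flushedValue (take (j ∸ F) r) + inTransit F (take j r) ∎
  where open ≡-Reasoning

available-take : ∀ C F r {j} → j ℕ.≤ length r →
  available C F (take j r) ≡
  C - (settledValue (take j r) - settledValue (take (j ∸ F) r)) - committed (take (j ∸ F) r)
available-take C F r {j} j≤n = begin
  C - (settledValue (take j r) - flushedValue (take j r)) - inTransit F (take j r)
    ≡⟨ cong (λ Φ → C - (settledValue (take j r) - Φ) - inTransit F (take j r))
            (inTransit-take F r j≤n) ⟩
  C - (settledValue (take j r) - (flushedValue (take (j ∸ F) r) + inTransit F (take j r)))
    - inTransit F (take j r)
    ≡⟨ available-identity C (settledValue (take j r)) (settledValue (take (j ∸ F) r))
                         (flushedValue (take (j ∸ F) r)) (inTransit F (take j r)) ⟩
  C - (settledValue (take j r) - settledValue (take (j ∸ F) r)) - committed (take (j ∸ F) r) ∎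
  where open ≡-Reasoning

-- Feasible runs

FeasibleStep : ℚ → ℕ → List Step → Step → Set
FeasibleStep C F h s =
  (settled s ≡ true → value s ≤ available C F h) × (flushed s ≤ committed h + settledAmt s)

FeasibleFrom-at : ∀ {C F} h r {j} → FeasibleFrom C F h r → j ℕ.< length r →
  FeasibleStep C F (h ++ take j r) (nth idle r j)
FeasibleFrom-at {C} {F} h (s ∷ r) {zero}  (fits , _ , flush≤ , _) _ =
  subst (λ h′ → FeasibleStep C F h′ s) (sym (++-identityʳ h)) (fits , flush≤)
FeasibleFrom-at {C} {F} h (s ∷ r) {suc j} (_ , _ , _ , rest) (s≤s j<n) =
  subst (λ h′ → FeasibleStep C F h′ (nth idle r j)) (++-assoc h [ s ] (take j r))
    (FeasibleFrom-at (h ++ [ s ]) r rest j<n)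

module _ {C : ℚ} {F : ℕ} {r : List Step} (feasible : Feasible C F r) where

  committed-take-nonneg : ∀ {j} → j ℕ.≤ length r → 0ℚ ≤ committed (take j r)
  committed-take-nonneg {zero}  _ = ≤-refl
  committed-take-nonneg {suc j} j<n =
    subst (0ℚ ≤_) (sym (committed-take-suc r j<n))
      (p≤q⇒0≤q-p (proj₂ (FeasibleFrom-at [] r feasible j<n)))

  feasible-window-bound : 0ℚ ≤ C → All (λ s → 0ℚ ≤ value s) r → ∀ {j} → j ℕ.< length r →
    settledValue (take (suc j) r) ≤ C + settledValue (take (j ∸ F) r)
  feasible-window-bound 0≤C 0≤values {j} j<n =
    subst (_≤ C + S (j ∸ F)) (sym (settledValue-take-suc r j<n))
      (slot (nth idle r j) (proj₁ (FeasibleFrom-at [] r feasible j<n)))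
    where
    S : ℕ → ℚ
    S i = settledValue (take i r)
    S≤C+window : ∀ {i} → i ℕ.≤ j → S i ≤ C + S (i ∸ F)
    S≤C+window {zero}  _    =
      subst (λ m → 0ℚ ≤ C + S m) (sym (ℕ.0∸n≡0 F)) (subst (0ℚ ≤_) (sym (+-identityʳ C)) 0≤C)
    S≤C+window {suc i} i<j  =
      ≤-trans (feasible-window-bound 0≤C 0≤values (ℕ.<-≤-trans i<j (ℕ.<⇒≤ j<n)))
              (+-monoʳ-≤ C (settledValue-take-mono 0≤values (ℕ.∸-monoˡ-≤ F (ℕ.n≤1+n i))))
    slot : ∀ s → (settled s ≡ true → value s ≤ available C F (take j r)) →
           S j + settledAmt s ≤ C + S (j ∸ F)
    slot (step v true  f) fits = settle-within-window {C} {S j} {S (j ∸ F)}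
      (subst (v ≤_) (available-take C F r (ℕ.<⇒≤ j<n)) (fits refl))
      (committed-take-nonneg (ℕ.≤-trans (ℕ.m∸n≤m j F) (ℕ.<⇒≤ j<n)))
    slot (step v false f) _    =
      subst (_≤ C + S (j ∸ F)) (sym (+-identityʳ (S j))) (S≤C+window ℕ.≤-refl)

-- The threshold algorithm

data ThresholdStep (C : ℚ) (F : ℕ) (η : ℚ) (h : List Step) (v : ℚ) : Step → Set where
  settle-flush : ThresholdStep C F η h v (step v true (η * C))
  settle-keep  : committed h + v < η * C → ThresholdStep C F η h v (step v true 0ℚ)
  skip-empty   : v ≤ 0ℚ → ThresholdStep C F η h v (step v false 0ℚ)
  skip-short   : available C F h < v → ThresholdStep C F η h v (step v false 0ℚ)

thresholdDecide-view : ∀ C F η h v → ThresholdStep C F η h v (thresholdDecide C F η h v)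
thresholdDecide-view C F η h v = view (0ℚ <? v) (v ≤? available C F h) (η * C ≤? committed h + v)
  where
  view : (pos : Dec (0ℚ < v)) (fits : Dec (v ≤ available C F h))
         (full : Dec (η * C ≤ committed h + v)) →
         ThresholdStep C F η h v
           (if does pos ∧ does fits
            then step v true (if does full then η * C else 0ℚ)
            else step v false 0ℚ)
  view (no ¬pos) _          _          = skip-empty (≮⇒≥ ¬pos)
  view (yes _)   (no ¬fits) _          = skip-short (≰⇒> ¬fits)
  view (yes _)   (yes _)    (yes _)    = settle-flush
  view (yes _)   (yes _)    (no ¬full) = settle-keep (≰⇒> ¬full)

ThresholdStep-committed< : ∀ {C F η h v T s} → committed h < η * C → v ≤ T → T ≤ η * C →
  ThresholdStep C F η h v s → committed h + settledAmt s - flushed s < η * C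
ThresholdStep-committed< R<ηC v≤T T≤ηC settle-flush          = flush-restores R<ηC v≤T T≤ηC
ThresholdStep-committed< R<ηC _   _    (settle-keep R+v<ηC) = subst (_< _) (sym (+-identityʳ _)) R+v<ηC
ThresholdStep-committed< R<ηC _   _    (skip-empty _)       = subst (_< _) (sym (p+0-0≡p _)) R<ηC
ThresholdStep-committed< R<ηC _   _    (skip-short _)       = subst (_< _) (sym (p+0-0≡p _)) R<ηC

ThresholdStep-gains-or-short : ∀ {C F η h v s} → ThresholdStep C F η h v s →
  v ≤ settledAmt s ⊎ (available C F h < v × settledAmt s ≡ 0ℚ)
ThresholdStep-gains-or-short settle-flush     = inj₁ ≤-refl
ThresholdStep-gains-or-short (settle-keep _)  = inj₁ ≤-refl
ThresholdStep-gains-or-short (skip-empty v≤0) = inj₁ v≤0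
ThresholdStep-gains-or-short (skip-short v>a) = inj₂ (v>a , refl)

thresholdFrom-length : ∀ C F η h vs → length (thresholdFrom C F η h vs) ≡ length vs
thresholdFrom-length C F η h []       = refl
thresholdFrom-length C F η h (v ∷ vs) = cong suc (thresholdFrom-length C F η _ vs)

thresholdFrom-at : ∀ C F η h vs {j} → j ℕ.< length vs →
  nth idle (thresholdFrom C F η h vs) j ≡
  thresholdDecide C F η (h ++ take j (thresholdFrom C F η h vs)) (nth 0ℚ vs j)
thresholdFrom-at C F η h (v ∷ vs) {zero} _ =
  cong (λ h′ → thresholdDecide C F η h′ v) (sym (++-identityʳ h))
thresholdFrom-at C F η h (v ∷ vs) {suc j} (s≤s j<n) =
  trans (thresholdFrom-at C F η (h ++ [ s ]) vs j<n)
        (cong (λ h′ → thresholdDecide C F η h′ (nth 0ℚ vs j))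
              (++-assoc h [ s ] (take j (thresholdFrom C F η (h ++ [ s ]) vs))))
  where s = thresholdDecide C F η h v

thresholdRun-length : ∀ C F η vs → length (thresholdRun C F η vs) ≡ length vs
thresholdRun-length C F η = thresholdFrom-length C F η []

thresholdRun-view : ∀ C F η vs {j} → j ℕ.< length vs →
  ThresholdStep C F η (take j (thresholdRun C F η vs)) (nth 0ℚ vs j) (nth idle (thresholdRun C F η vs) j)
thresholdRun-view C F η vs j<n =
  subst (ThresholdStep C F η _ _) (sym (thresholdFrom-at C F η [] vs j<n)) (thresholdDecide-view C F η _ _)

thresholdRun-committed< : ∀ {C F η T} vs → 0ℚ < η * C → T ≤ η * C → All (_≤ T) vs →
  ∀ {j} → j ℕ.≤ length vs → committed (take j (thresholdRun C F η vs)) < η * C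
thresholdRun-committed< vs 0<ηC _ _ {zero} _ = 0<ηC
thresholdRun-committed< {C} {F} {η} vs 0<ηC T≤ηC vs≤T {suc j} j<n =
  subst (_< η * C) (sym (committed-take-suc arun (subst (j ℕ.<_) (sym (thresholdRun-length C F η vs)) j<n)))
    (ThresholdStep-committed< (thresholdRun-committed< vs 0<ηC T≤ηC vs≤T (ℕ.<⇒≤ j<n))
                              (All-nth 0ℚ vs≤T j<n) T≤ηC (thresholdRun-view C F η vs j<n))
  where arun = thresholdRun C F η vs

-- The competitive ratio

module CompetitiveRatio
  (C T η : ℚ) (F : ℕ) (0<C : 0ℚ < C) (0<T : 0ℚ < T) (T≤ηC : T ≤ η * C) (ηC+T<C : η * C + T < C)
  (run : List Step) (values-bounded : All (λ s → 0ℚ ≤ value s × value s ≤ T) run)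
  (feasible : Feasible C F run)
  where

  Tx : List ℚ
  Tx = map value run

  n : ℕ
  n = length run

  arun : List Step
  arun = thresholdRun C F η Tx

  Sₒ Sₐ : ℕ → ℚ
  Sₒ j = settledValue (take j run)
  Sₐ j = settledValue (take j arun)

  slack : ℚ
  slack = C - η * C - T

  0≤slack : 0ℚ ≤ slack
  0≤slack = <⇒≤ (slack-positive ηC+T<C)

  slack≤C : slack ≤ C
  slack≤C = slack-≤ (<⇒≤ (<-≤-trans 0<T T≤ηC)) (<⇒≤ 0<T)

  length-arun : length arun ≡ n
  length-arun = trans (thresholdRun-length C F η Tx) (length-map value run)

  0≤values : All (λ s → 0ℚ ≤ value s) run
  0≤values = All.map proj₁ values-bounded

  Tx≤T : All (_≤ T) Tx
  Tx≤T = map⁺ (All.map proj₂ values-bounded)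

  ≤n⇒≤length-Tx : ∀ {j} → j ℕ.≤ n → j ℕ.≤ length Tx
  ≤n⇒≤length-Tx {j} = subst (j ℕ.≤_) (sym (length-map value run))

  committed-arun< : ∀ {j} → j ℕ.≤ n → committed (take j arun) < η * C
  committed-arun< j≤n =
    thresholdRun-committed< Tx (<-≤-trans 0<T T≤ηC) T≤ηC Tx≤T (≤n⇒≤length-Tx j≤n)

  short⇒window-gain : ∀ {j v} → j ℕ.≤ n → available C F (take j arun) < v → v ≤ T →
    slack + Sₐ (j ∸ F) < Sₐ j
  short⇒window-gain {j} j≤n short v≤T = reject-within-window {C} {Sₐ j} {Sₐ (j ∸ F)}
    (subst (_< _) (available-take C F arun (subst (j ℕ.≤_) (sym length-arun) j≤n)) short)
    v≤T
    (committed-arun< (ℕ.≤-trans (ℕ.m∸n≤m j F) j≤n))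

  ratio-step : ∀ {i} → i ℕ.< n → (∀ {m} → m ℕ.≤ i → Sₒ m * slack ≤ C * Sₐ m) →
    Sₒ (suc i) * slack ≤ C * Sₐ (suc i)
  ratio-step {i} i<n ih =
    subst₂ (λ o a → o * slack ≤ C * a)
      (sym (settledValue-take-suc run i<n)) (sym (settledValue-take-suc arun i<length-arun))
      (slot (ThresholdStep-gains-or-short view))
    where
    sₒ sₐ : Step
    sₒ = nth idle run i
    sₐ = nth idle arun i
    i<length-arun : i ℕ.< length arun
    i<length-arun = subst (i ℕ.<_) (sym length-arun) i<n
    view : ThresholdStep C F η (take i arun) (value sₒ) sₐ
    view = subst (λ v → ThresholdStep C F η (take i arun) v sₐ) (nth-map value idle run i)
             (thresholdRun-view C F η Tx (≤n⇒≤length-Tx i<n))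
    0≤v : 0ℚ ≤ value sₒ
    0≤v = All-nth idle 0≤values i<n
    slot : value sₒ ≤ settledAmt sₐ ⊎ (available C F (take i arun) < value sₒ × settledAmt sₐ ≡ 0ℚ) →
           (Sₒ i + settledAmt sₒ) * slack ≤ C * (Sₐ i + settledAmt sₐ)
    slot (inj₁ v≤gain) =
      gain-preserves-ratio {X = Sₒ i} (ih ℕ.≤-refl) (≤-trans (settledAmt-≤-value sₒ 0≤v) v≤gain)
        (≤-trans 0≤v v≤gain) 0≤slack slack≤C
    slot (inj₂ (short , no-gain)) =
      window-preserves-ratio
        (subst (_≤ C + Sₒ (i ∸ F)) (settledValue-take-suc run i<n)
          (feasible-window-bound feasible (<⇒≤ 0<C) 0≤values i<n))
        (ih (ℕ.m∸n≤m i F))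
        (subst (slack + Sₐ (i ∸ F) ≤_) (sym (trans (cong (Sₐ i +_) no-gain) (+-identityʳ (Sₐ i))))
          (<⇒≤ (short⇒window-gain (ℕ.<⇒≤ i<n) short (proj₂ (All-nth idle values-bounded i<n)))))
        0≤slack (<⇒≤ 0<C)

  ratio-prefix : ∀ j → j ℕ.≤ n → Sₒ j * slack ≤ C * Sₐ j
  ratio-prefix = <-rec _ prefix
    where
    prefix : ∀ j → (∀ {m} → m ℕ.< j → m ℕ.≤ n → Sₒ m * slack ≤ C * Sₐ m) →
             j ℕ.≤ n → Sₒ j * slack ≤ C * Sₐ j
    prefix zero    _  _   = ≤-reflexive (trans (*-zeroˡ slack) (sym (*-zeroʳ C)))
    prefix (suc i) ih i<n = ratio-step i<n (λ m≤i → ih (s≤s m≤i) (ℕ.≤-trans m≤i (ℕ.<⇒≤ i<n)))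

  competitive-ratio : settledValue run * slack ≤ C * V-threshold C F η Tx
  competitive-ratio = subst₂ (λ o a → settledValue o * slack ≤ C * settledValue a)
    (take-all n run ℕ.≤-refl) (take-all n arun (ℕ.≤-reflexive length-arun)) (ratio-prefix n ℕ.≤-refl)

lemma1 : (C T η : ℚ) (F : ℕ) → 0 Data.Nat.< F →
    0ℚ < C → 0ℚ < T → T ≤ η * C → η ≤ 1ℚ → η * C + T < C →
    (Tx : List ℚ) → All (λ x → 0ℚ ≤ x × x ≤ T) Tx →
    (run : List Step) → RunOn Tx run → Feasible C F run →
    settledValue run * (C - η * C - T) ≤ C * V-threshold C F η Tx
lemma1 C T η F _ 0<C 0<T T≤ηC _ ηC+T<C .(map value run) Tx-bounded run refl feasible =
  CompetitiveRatio.competitive-ratio C T η F 0<C 0<T T≤ηC ηC+T<C run (map⁻ Tx-bounded) feasible
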